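{- Let $c$ be even and let $\rho:V\to M^\infty_G$ be a ranking function. Suppose we are given the sets $S_\top=\{v\in V\mid\rho(v)=\top\}$ and, for each odd $i\in\{1,3,\dots,c-1\}$ and each $x\in\{0,\dots,n_i\}$, the set $C^i_x=\{v\in V\mid \rho(v)\neq\top \text{ and the } i\text{ -th entry of }\rho(v)\text{ equals }x\}$. Then for any rank $r\in M^\infty_G$ the set $S_r=\{v\in V\mid \rho(v)\ge r\}$ can be computed from these sets with $O(n)$ symbolic set operations ($\cup,\cap,\setminus$) and no symbolic one-step operation.
   Context: $V$ is a set of $n$ vertices with a priority function $\alpha:V\to\{0,\dots,c-1\}$ such that $P_i=\{v\mid\alpha(v)=i\}\ne\emptyset$ for $0<i<c$. For odd $i$ let $n_i=|P_i|$, for even $i$ let $n_i=0$. $M_G=\prod_{i=0}^{c-1}\{0,\dots,n_i\}$ (vectors indexed $0,\dots,c-1$, so even entries are always $0$), and $M^\infty_G=M_G\cup\{\top\}$. Ranks are ordered lexicographically where index $0$ is the least significant and index $c-1$ the most significant entry, and $\top$ is the maximum element. A ranking function is any map $\rho:V\to M^\infty_G$. Sets are manipulated only by set operations (union, intersection, difference, inclusion, equality), each counted as one symbolic set operation. -}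

module Defs where

open import Data.Nat using (ℕ; _%_; _<_; _≤_)
open import Data.Nat.Divisibility using (_∣_)
import Data.Nat as ℕ
open import Data.Fin using (Fin; toℕ; zero; suc)
open import Data.Unit using (⊤)
open import Data.Empty using (⊥)
open import Data.Fin.Properties using (_≟_)
open import Data.List using (List; length; filter)
open import Data.List.Base using (allFin)
open import Data.Product using (Σ; ∃; _×_; _,_)
open import Data.Sum using (_⊎_)
open import Relation.Binary.PropositionalEquality using (_≡_; _≢_)
open import Relation.Nullary using (¬_)

-- Game vertices V = Fin n, priorities α : V → {0,…,c-1} = Fin c.

|P| : {n c : ℕ} → (Fin n → Fin c) → Fin c → ℕ
|P| {n} α i = length (filter (λ v → α v ≟ i) (allFin n))

nᵢ : {n c : ℕ} → (Fin n → Fin c) → Fin c → ℕ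
nᵢ α i with toℕ i % 2
... | ℕ.zero  = 0
... | ℕ.suc _ = |P| α i

PrioritiesNonempty : {n c : ℕ} → (Fin n → Fin c) → Set
PrioritiesNonempty {n} {c} α = (i : Fin c) → 0 < toℕ i → ∃ λ (v : Fin n) → α v ≡ i

MG : {n c : ℕ} → (Fin n → Fin c) → Set
MG {c = c} α = (i : Fin c) → Fin (ℕ.suc (nᵢ α i))

data Rank {n c : ℕ} (α : Fin n → Fin c) : Set where
  top : Rank α
  vec : MG α → Rank α

-- strict lexicographic order on M_G; index c-1 most significant, index 0 least
_<ᴹ_ : {n c : ℕ} {α : Fin n → Fin c} → MG α → MG α → Set
_<ᴹ_ {c = c} f g =
  Σ (Fin c) λ j → (toℕ (f j) < toℕ (g j)) ×
    ((k : Fin c) → toℕ j < toℕ k → toℕ (f k) ≡ toℕ (g k))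

_≤ᴿ_ : {n c : ℕ} {α : Fin n → Fin c} → Rank α → Rank α → Set
_     ≤ᴿ top   = ⊤
top   ≤ᴿ vec g = ⊥
_≤ᴿ_ {c = c} (vec f) (vec g) = ((i : Fin c) → f i ≡ g i) ⊎ (f <ᴹ g)

RankingFunction : {n c : ℕ} → (Fin n → Fin c) → Set
RankingFunction {n} α = Fin n → Rank α

-- Symbolic computations: straight-line programs of set operations
-- over a type I of given input sets. Cost = number of instructions.

data SetOp : Set where
  ∪op ∩op ∖op : SetOp

data Operand (I : Set) (k : ℕ) : Set where
  input : I → Operand I k
  prev  : Fin k → Operand I k

data SLP (I : Set) : ℕ → Set where
  []  : SLP I 0
  _▷_ : {k : ℕ} → SLP I k → SetOp × Operand I k × Operand I k → SLP I (ℕ.suc k)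

module _ {I : Set} {n : ℕ} (⟦_⟧ : I → Fin n → Set) where

  applyOp : SetOp → (Fin n → Set) → (Fin n → Set) → Fin n → Set
  applyOp ∪op A B v = A v ⊎ B v
  applyOp ∩op A B v = A v × B v
  applyOp ∖op A B v = A v × ¬ B v

  results : {k : ℕ} → SLP I k → Fin k → Fin n → Set
  evalOperand : {k : ℕ} → SLP I k → Operand I k → Fin n → Set

  evalOperand p (input x) = ⟦ x ⟧
  evalOperand p (prev j)  = results p j

  results (p ▷ (o , a , b)) zero    = applyOp o (evalOperand p a) (evalOperand p b)
  results (p ▷ _)           (suc j) = results p j

data Given {n c : ℕ} (α : Fin n → Fin c) : Set where
  S⊤ : Given α
  C  : (i : Fin c) → toℕ i % 2 ≡ 1 → (x : ℕ) → x ≤ nᵢ α i → Given α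

⟦_⟧Given : {n c : ℕ} {α : Fin n → Fin c} → RankingFunction α → Given α → Fin n → Set
⟦ ρ ⟧Given S⊤ v = ρ v ≡ top
⟦ ρ ⟧Given (C i _ x _) v = Σ (MG _) λ f → (ρ v ≡ vec f) × (toℕ (f i) ≡ x)

module Submission where

-- The set S_r = {v | r ≤ ρ(v)} is built as an expression tree over the
-- given sets S_⊤ and C^i_x; the tree is then flattened into a
-- straight-line program with one instruction per inner node.
--
-- For r = ⊤ the answer is S_⊤ itself.  For a vector rank f the vertices
-- with a vector rank g ≥ f are found by scanning the indices from the least
-- significant one upwards.  Writing L_m g for "g ≥ f lexicographically on
-- the indices below m", L_0 holds for every g and
--      L_{m+1} g  ⇔  f_m < g_m  ∨  (g_m = f_m ∧ L_m g).
-- At an even index both entries are 0, so L_{m+1} = L_m; at an odd index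
-- the right-hand side is (⋃_{y ≥ f_m} C^m_y ∖ C^m_{f_m}) ∪ (C^m_{f_m} ∩ L_m),
-- costing 3 + (n_m − f_m) ≤ 4·|P_m| operations because P_m ≠ ∅.  Starting
-- from the vertices of vector rank, ⋃_y C^1_y (at most n operations), and
-- using that the classes P_i are disjoint, S_f costs at most 5·(n+1).

open import Defs
open import Data.Nat using (ℕ; suc; _*_; _≤_)
open import Data.Nat.Divisibility using (_∣_)
open import Data.Fin using (Fin)
open import Data.Product using (Σ; ∃; _×_)
open import Function.Bundles using (_⇔_)

open import Level using (0ℓ)
open import Data.Nat using (zero; _+_; _<_; _∸_; _%_; _<?_; s≤s; z≤n)
open import Data.Nat.Properties
open import Data.Nat.DivMod using (m%n<n)
open import Data.Nat.Divisibility using (∣1⇒≡1)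
open import Data.Nat.Tactic.RingSolver using (solve-∀)
open import Data.Fin using (toℕ; fromℕ<)
open import Data.Fin.Properties using (toℕ<n; toℕ-fromℕ<; toℕ-injective; ¬Fin0)
  renaming (_≟_ to _≟ᶠ_)
open import Data.Product using (_,_; proj₁; proj₂)
open import Data.Sum using (_⊎_; inj₁; inj₂; [_,_]′)
open import Data.Empty using (⊥-elim)
open import Data.Unit using (tt)
open import Data.List using (List; []; _∷_; length; filter; allFin)
open import Data.List.Properties using (length-filter; length-tabulate)
open import Data.List.Membership.Propositional.Properties using (∈-filter⁺; ∈-allFin; ∈-length)
open import Relation.Nullary using (¬_; yes; no)
open import Relation.Unary using (Pred; Decidable; _≐_; _∪_; _∩_; ∁)
open import Relation.Unary.Properties using (≐-refl; ≐-sym; ≐-trans)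
open import Relation.Unary.Algebra using (∪-cong; ∩-cong)
open import Relation.Unary.Relation.Binary.Equality using (≐-setoid)
open import Relation.Binary.PropositionalEquality using (_≡_; refl; sym; trans; cong; cong₂; subst)
open import Function.Bundles using (mk⇔)

data Expr (I : Set) : Set where
  inp  : I → Expr I
  node : SetOp → Expr I → Expr I → Expr I

size : {I : Set} → Expr I → ℕ
size (inp _)      = 0
size (node _ a b) = suc (size a + size b)

evalExpr : {I : Set} {n : ℕ} → (I → Pred (Fin n) 0ℓ) → Expr I → Pred (Fin n) 0ℓ
evalExpr ⟦_⟧ (inp x)      = ⟦ x ⟧
evalExpr ⟦_⟧ (node o a b) = applyOp ⟦_⟧ o (evalExpr ⟦_⟧ a) (evalExpr ⟦_⟧ b)

record _⊑_ {I : Set} {k l : ℕ} (p : SLP I k) (q : SLP I l) : Set₁ where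
  field
    lift       : Operand I k → Operand I l
    lift-sound : {n : ℕ} (⟦_⟧ : I → Pred (Fin n) 0ℓ) (x : Operand I k) →
                 evalOperand ⟦_⟧ q (lift x) ≡ evalOperand ⟦_⟧ p x
open _⊑_

⊑-refl : {I : Set} {k : ℕ} {p : SLP I k} → p ⊑ p
⊑-refl = record { lift = λ x → x ; lift-sound = λ _ _ → refl }

⊑-trans : {I : Set} {k l m : ℕ} {p : SLP I k} {q : SLP I l} {r : SLP I m} →
          p ⊑ q → q ⊑ r → p ⊑ r
⊑-trans p⊑q q⊑r = record
  { lift       = λ x → lift q⊑r (lift p⊑q x)
  ; lift-sound = λ ⟦_⟧ x → trans (lift-sound q⊑r ⟦_⟧ (lift p⊑q x)) (lift-sound p⊑q ⟦_⟧ x)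
  }

⊑-▷ : {I : Set} {k : ℕ} (p : SLP I k) (ins : SetOp × Operand I k × Operand I k) → p ⊑ (p ▷ ins)
⊑-▷ {I} {k} p ins = record { lift = shift ; lift-sound = λ _ → shift-sound }
  where
  shift : Operand I k → Operand I (suc k)
  shift (input x) = input x
  shift (prev j)  = prev (Data.Fin.suc j)
  shift-sound : {n : ℕ} {⟦_⟧ : I → Pred (Fin n) 0ℓ} (x : Operand I k) →
                evalOperand ⟦_⟧ (p ▷ ins) (shift x) ≡ evalOperand ⟦_⟧ p x
  shift-sound (input x) = refl
  shift-sound (prev j)  = refl

record Compiled {I : Set} {k : ℕ} (p : SLP I k) (e : Expr I) : Set₁ where
  field
    {len}        : ℕ
    program      : SLP I len
    extends      : p ⊑ program
    result       : Operand I len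
    result-sound : {n : ℕ} (⟦_⟧ : I → Pred (Fin n) 0ℓ) →
                   evalOperand ⟦_⟧ program result ≡ evalExpr ⟦_⟧ e
    len-bound    : len ≤ size e + k
open Compiled

compile : {I : Set} {k : ℕ} (p : SLP I k) (e : Expr I) → Compiled p e
compile p (inp x) = record
  { program = p ; extends = ⊑-refl ; result = input x
  ; result-sound = λ _ → refl ; len-bound = ≤-refl }
compile {I} {k} p (node op a b) = record
  { program      = program B ▷ ins
  ; extends      = ⊑-trans (extends A) (⊑-trans (extends B) (⊑-▷ (program B) ins))
  ; result       = prev Data.Fin.zero
  ; result-sound = λ ⟦_⟧ → cong₂ (applyOp ⟦_⟧ op)
      (trans (lift-sound (extends B) ⟦_⟧ (result A)) (result-sound A ⟦_⟧))
      (result-sound B ⟦_⟧)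
  ; len-bound    = s≤s (≤-trans (len-bound B) (≤-trans (+-monoʳ-≤ (size b) (len-bound A))
                     (≤-reflexive (regroup (size a) (size b) k))))
  }
  where
  A : Compiled p a
  A = compile p a
  B : Compiled (program A) b
  B = compile (program A) b
  ins : SetOp × Operand I (len B) × Operand I (len B)
  ins = op , lift (extends B) (result A) , result B
  regroup : (x y z : ℕ) → y + (x + z) ≡ x + y + z
  regroup = solve-∀

realise : {I R : Set} {n K : ℕ} (⟦_⟧ : R → I → Pred (Fin n) 0ℓ) (T : R → Pred (Fin n) 0ℓ)
          (e : Expr I) → size e ≤ K → ((ρ : R) → evalExpr ⟦ ρ ⟧ e ≐ T ρ) →
          Σ ℕ λ k → (k ≤ K) × Σ (SLP I k) λ p → Σ (Operand I k) λ out →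
            (ρ : R) (v : Fin n) → evalOperand ⟦ ρ ⟧ p out v ⇔ T ρ v
realise ⟦_⟧ T e size≤K sem =
    len E , ≤-trans (≤-trans (len-bound E) (≤-reflexive (+-identityʳ (size e)))) size≤K
  , program E , result E
  , λ ρ v → mk⇔ (λ w → proj₁ (sem ρ) (subst (λ A → A v) (result-sound E ⟦ ρ ⟧) w))
                (λ w → subst (λ A → A v) (sym (result-sound E ⟦ ρ ⟧)) (proj₂ (sem ρ) w))
  where
  E : Compiled [] e
  E = compile [] e

below-suc-split : {c : ℕ} {k i : Fin c} → toℕ k < suc (toℕ i) → k ≡ i ⊎ toℕ k < toℕ i
below-suc-split k<1+i with m<1+n⇒m<n∨m≡n k<1+i
... | inj₁ k<i = inj₂ k<i
... | inj₂ k≡i = inj₁ (toℕ-injective k≡i)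

module Lexicographic {c : ℕ} (f : Fin c → ℕ) where

  LexBelow : ℕ → Pred (Fin c → ℕ) 0ℓ
  LexBelow m g =
      ((k : Fin c) → toℕ k < m → f k ≡ g k)
    ⊎ Σ (Fin c) λ j → (toℕ j < m) × (f j < g j) ×
        ((k : Fin c) → toℕ j < toℕ k → toℕ k < m → f k ≡ g k)

  lex-zero : {g : Fin c → ℕ} → LexBelow 0 g
  lex-zero = inj₁ λ _ ()

  lex-suc : (i : Fin c) →
            LexBelow (suc (toℕ i)) ≐ (λ g → f i < g i) ∪ ((λ g → f i ≡ g i) ∩ LexBelow (toℕ i))
  lex-suc i = to , from
    where
    to : ∀ {g} → LexBelow (suc (toℕ i)) g → f i < g i ⊎ (f i ≡ g i × LexBelow (toℕ i) g)
    to (inj₁ agree) = inj₂ (agree i (n<1+n _) , inj₁ λ k k<i → agree k (m<n⇒m<1+n k<i))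
    to (inj₂ (j , j<1+i , lt , above)) with below-suc-split j<1+i
    ... | inj₁ refl = inj₁ lt
    ... | inj₂ j<i  = inj₂ ( above i j<i (n<1+n _)
                           , inj₂ (j , j<i , lt , λ k j<k k<i → above k j<k (m<n⇒m<1+n k<i)))
    from : ∀ {g} → f i < g i ⊎ (f i ≡ g i × LexBelow (toℕ i) g) → LexBelow (suc (toℕ i)) g
    from (inj₁ lt) =
      inj₂ (i , n<1+n _ , lt , λ k i<k k<1+i → ⊥-elim (<⇒≱ i<k (≤-pred k<1+i)))
    from (inj₂ (eq , inj₁ agree)) =
      inj₁ λ k k<1+i → [ (λ { refl → eq }) , agree k ]′ (below-suc-split k<1+i)
    from (inj₂ (eq , inj₂ (j , j<i , lt , above))) =
      inj₂ ( j , m<n⇒m<1+n j<i , lt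
           , λ k j<k k<1+i → [ (λ { refl → eq }) , above k j<k ]′ (below-suc-split k<1+i))

  lex-all : LexBelow c ≐ λ g → ((k : Fin c) → f k ≡ g k)
                             ⊎ Σ (Fin c) λ j → (f j < g j) × ((k : Fin c) → toℕ j < toℕ k → f k ≡ g k)
  lex-all = (λ { (inj₁ agree) → inj₁ λ k → agree k (toℕ<n k)
               ; (inj₂ (j , _ , lt , above)) → inj₂ (j , lt , λ k j<k → above k j<k (toℕ<n k)) })
          , (λ { (inj₁ agree) → inj₁ λ k _ → agree k
               ; (inj₂ (j , lt , above)) → inj₂ (j , toℕ<n j , lt , λ k j<k _ → above k j<k) })

module _ {A : Set} {P Q R : Pred A 0ℓ}
         (P? : Decidable P) (Q? : Decidable Q) (R? : Decidable R)
         (R≐P∪Q : R ≐ P ∪ Q) (disjoint : ∀ {x} → P x → ¬ Q x) where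

  length-filter-disjoint-∪ : (xs : List A) →
    length (filter R? xs) ≡ length (filter P? xs) + length (filter Q? xs)
  length-filter-disjoint-∪ [] = refl
  length-filter-disjoint-∪ (x ∷ xs) with R? x | P? x | Q? x
  ... | yes _ | yes p | yes q = ⊥-elim (disjoint p q)
  ... | yes _ | yes _ | no _  = cong suc (length-filter-disjoint-∪ xs)
  ... | yes _ | no _  | yes _ = trans (cong suc (length-filter-disjoint-∪ xs)) (sym (+-suc _ _))
  ... | yes r | no ¬p | no ¬q = ⊥-elim ([ ¬p , ¬q ]′ (proj₁ R≐P∪Q r))
  ... | no ¬r | yes p | _     = ⊥-elim (¬r (proj₂ R≐P∪Q (inj₁ p)))
  ... | no ¬r | no _  | yes q = ⊥-elim (¬r (proj₂ R≐P∪Q (inj₂ q)))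
  ... | no _  | no _  | no _  = length-filter-disjoint-∪ xs

module Priorities {n c : ℕ} (α : Fin n → Fin c) where

  -- Every index either has only the entry 0 (even indices), or is odd,
  -- in which case the sets C^i_x are available as inputs.
  trivialOrOdd : (i : Fin c) → nᵢ α i ≡ 0 ⊎ toℕ i % 2 ≡ 1
  trivialOrOdd i with toℕ i % 2 | m%n<n (toℕ i) 2
  ... | 0           | _                = inj₁ refl
  ... | 1           | _                = inj₂ refl
  ... | suc (suc _) | s≤s (s≤s ())

  nᵢ≤|P| : (i : Fin c) → nᵢ α i ≤ |P| α i
  nᵢ≤|P| i with toℕ i % 2
  ... | zero  = z≤n
  ... | suc _ = ≤-refl

  |P|≤n : (i : Fin c) → |P| α i ≤ n
  |P|≤n i = ≤-trans (length-filter (λ v → α v ≟ᶠ i) (allFin n)) (≤-reflexive (length-tabulate _))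

  -- Odd indices are positive, so their priority classes are inhabited.
  |P|-odd-positive : PrioritiesNonempty α → (i : Fin c) → toℕ i % 2 ≡ 1 → 0 < |P| α i
  |P|-odd-positive nonempty i odd =
    let v , αv≡i = nonempty i (odd⇒positive (toℕ i) odd)
    in  ∈-length (∈-filter⁺ (λ w → α w ≟ᶠ i) (∈-allFin v) αv≡i)
    where
    odd⇒positive : (m : ℕ) → m % 2 ≡ 1 → 0 < m
    odd⇒positive (suc _) _ = s≤s z≤n

  entry≤nᵢ : (g : MG α) (i : Fin c) → toℕ (g i) ≤ nᵢ α i
  entry≤nᵢ g i = ≤-pred (toℕ<n (g i))

  trivial-entry : {i : Fin c} → nᵢ α i ≡ 0 → (g : MG α) → toℕ (g i) ≡ 0
  trivial-entry {i} nᵢ≡0 g = n≤0⇒n≡0 (≤-trans (entry≤nᵢ g i) (≤-reflexive nᵢ≡0))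

  below : ℕ → ℕ
  below m = length (filter (λ v → toℕ (α v) <? m) (allFin n))

  below≤n : (m : ℕ) → below m ≤ n
  below≤n m = ≤-trans (length-filter (λ v → toℕ (α v) <? m) (allFin n)) (≤-reflexive (length-tabulate _))

  below-suc : (i : Fin c) {m : ℕ} → toℕ i ≡ m → below (suc m) ≡ |P| α i + below m
  below-suc i refl = length-filter-disjoint-∪ (λ v → α v ≟ᶠ i) (λ v → toℕ (α v) <? toℕ i)
    (λ v → toℕ (α v) <? suc (toℕ i)) (below-suc-split , join) (λ { refl → <-irrefl refl }) (allFin n)
    where
    join : ∀ {v} → α v ≡ i ⊎ toℕ (α v) < toℕ i → toℕ (α v) < suc (toℕ i)
    join (inj₁ refl) = n<1+n _
    join (inj₂ lt)   = m<n⇒m<1+n lt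

module RankSets {n c : ℕ} {α : Fin n → Fin c} (ρ : RankingFunction α) where

  -- The vertices whose rank is a vector (not ⊤) satisfying P.
  -- The input C^i_x is RankSat (λ g → toℕ (g i) ≡ x) by definition.
  RankSat : Pred (MG α) 0ℓ → Pred (Fin n) 0ℓ
  RankSat P v = Σ (MG α) λ g → (ρ v ≡ vec g) × P g

  RankSat-cong : {P Q : Pred (MG α) 0ℓ} → P ≐ Q → RankSat P ≐ RankSat Q
  RankSat-cong (P⊆Q , Q⊆P) = (λ (g , e , p) → g , e , P⊆Q p) , (λ (g , e , q) → g , e , Q⊆P q)

  -- Since each vertex has a single rank, RankSat commutes with the set operations.
  RankSat-∪ : {P Q : Pred (MG α) 0ℓ} → RankSat P ∪ RankSat Q ≐ RankSat (P ∪ Q)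
  RankSat-∪ = (λ { (inj₁ (g , e , p)) → g , e , inj₁ p ; (inj₂ (g , e , q)) → g , e , inj₂ q })
            , (λ { (g , e , inj₁ p) → inj₁ (g , e , p) ; (g , e , inj₂ q) → inj₂ (g , e , q) })

  RankSat-∩ : {P Q : Pred (MG α) 0ℓ} → RankSat P ∩ RankSat Q ≐ RankSat (P ∩ Q)
  RankSat-∩ {P} {Q} = to , λ (g , e , p , q) → (g , e , p) , (g , e , q)
    where
    to : ∀ {v} → (RankSat P ∩ RankSat Q) v → RankSat (P ∩ Q) v
    to ((g , e , p) , (g′ , e′ , q)) with trans (sym e) e′
    ... | refl = g , e , p , q

  RankSat-∖ : {P Q : Pred (MG α) 0ℓ} → RankSat P ∩ ∁ (RankSat Q) ≐ RankSat (P ∩ ∁ Q)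
  RankSat-∖ {P} {Q} = (λ ((g , e , p) , ¬Q) → g , e , p , λ q → ¬Q (g , e , q)) , from
    where
    from : ∀ {v} → RankSat (P ∩ ∁ Q) v → (RankSat P ∩ ∁ (RankSat Q)) v
    from (g , e , p , ¬q) = (g , e , p) , λ (g′ , e′ , q) → ¬q (vec-unique e e′ q)
      where
      vec-unique : ∀ {v g g′} → ρ v ≡ vec g → ρ v ≡ vec g′ → Q g′ → Q g
      vec-unique e e′ q with trans (sym e) e′
      ... | refl = q

  top-upset : (λ v → ρ v ≡ top) ≐ (λ v → top ≤ᴿ ρ v)
  top-upset = to , from
    where
    to : ∀ {v} → ρ v ≡ top → top ≤ᴿ ρ v
    to eq rewrite eq = tt
    from : ∀ {v} → top ≤ᴿ ρ v → ρ v ≡ top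
    from {v} le with ρ v
    ... | top   = refl
    ... | vec _ = ⊥-elim le

  vec-upset : (f : MG α) → (λ v → ρ v ≡ top) ∪ RankSat (λ g → vec f ≤ᴿ vec g) ≐ (λ v → vec f ≤ᴿ ρ v)
  vec-upset f = to , from
    where
    to : ∀ {v} → ρ v ≡ top ⊎ RankSat (λ g → vec f ≤ᴿ vec g) v → vec f ≤ᴿ ρ v
    to (inj₁ eq) rewrite eq = tt
    to (inj₂ (g , eq , le)) rewrite eq = le
    from : ∀ {v} → vec f ≤ᴿ ρ v → ρ v ≡ top ⊎ RankSat (λ g → vec f ≤ᴿ vec g) v
    from {v} le with ρ v
    ... | top   = inj₁ refl
    ... | vec g = inj₂ (g , refl , le)

-- i₁ is an odd index; the sets C^{i₁}_x together cover all vertices of vector rank.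
module Construction {n c : ℕ} (α : Fin n → Fin c) (f : MG α)
                    (i₁ : Fin c) (i₁-odd : toℕ i₁ % 2 ≡ 1) where
  open Priorities α
  open Lexicographic (λ k → toℕ (f k)) using (LexBelow; lex-zero; lex-suc; lex-all)

  LexPrefix : ℕ → Pred (MG α) 0ℓ
  LexPrefix m g = LexBelow m (λ k → toℕ (g k))

  Above At : Fin c → Pred (MG α) 0ℓ
  Above i g = toℕ (f i) ≤ toℕ (g i)
  At    i g = toℕ (g i) ≡ toℕ (f i)

  lexPrefix-step : (i : Fin c) →
    LexPrefix (suc (toℕ i)) ≐ (Above i ∩ ∁ (At i)) ∪ (At i ∩ LexPrefix (toℕ i))
  lexPrefix-step i = (λ lx → to (proj₁ (lex-suc i) lx)) , (λ s → proj₂ (lex-suc i) (from s))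
    where
    to : ∀ {g} → toℕ (f i) < toℕ (g i) ⊎ (toℕ (f i) ≡ toℕ (g i) × LexPrefix (toℕ i) g) →
         ((Above i ∩ ∁ (At i)) ∪ (At i ∩ LexPrefix (toℕ i))) g
    to (inj₁ lt)        = inj₁ (<⇒≤ lt , λ eq → <⇒≢ lt (sym eq))
    to (inj₂ (eq , lx)) = inj₂ (sym eq , lx)
    from : ∀ {g} → ((Above i ∩ ∁ (At i)) ∪ (At i ∩ LexPrefix (toℕ i))) g →
           toℕ (f i) < toℕ (g i) ⊎ (toℕ (f i) ≡ toℕ (g i) × LexPrefix (toℕ i) g)
    from (inj₁ (le , ¬at)) = inj₁ (≤∧≢⇒< le λ eq → ¬at (sym eq))
    from (inj₂ (at , lx))  = inj₂ (sym at , lx)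

  lexPrefix-trivial-step : (i : Fin c) → nᵢ α i ≡ 0 → LexPrefix (suc (toℕ i)) ≐ LexPrefix (toℕ i)
  lexPrefix-trivial-step i trivial = to , λ {g} lx → proj₂ (lex-suc i) (inj₂ (tie g , lx))
    where
    tie : (g : MG α) → toℕ (f i) ≡ toℕ (g i)
    tie g = trans (trivial-entry trivial f) (sym (trivial-entry trivial g))
    to : ∀ {g} → LexPrefix (suc (toℕ i)) g → LexPrefix (toℕ i) g
    to {g} lx with proj₁ (lex-suc i) lx
    ... | inj₁ lt        = ⊥-elim (<⇒≢ lt (tie g))
    ... | inj₂ (_ , lx′) = lx′

  lexPrefix-all : LexPrefix c ≐ (λ g → vec f ≤ᴿ vec g)
  lexPrefix-all = (λ lx → to (proj₁ lex-all lx)) , (λ le → proj₂ lex-all (from le))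
    where
    to : ∀ {g : MG α} → ((k : Fin c) → toℕ (f k) ≡ toℕ (g k)) ⊎ f <ᴹ g → vec f ≤ᴿ vec g
    to (inj₁ agree) = inj₁ λ k → toℕ-injective (agree k)
    to (inj₂ lt)    = inj₂ lt
    from : ∀ {g : MG α} → vec f ≤ᴿ vec g → ((k : Fin c) → toℕ (f k) ≡ toℕ (g k)) ⊎ f <ᴹ g
    from (inj₁ agree) = inj₁ λ k → cong toℕ (agree k)
    from (inj₂ lt)    = inj₂ lt

  unionFrom : (i : Fin c) → toℕ i % 2 ≡ 1 → (x d : ℕ) → x + d ≡ nᵢ α i → Expr (Given α)
  unionFrom i odd x zero    x+d≡nᵢ = inp (C i odd x (≤-trans (m≤m+n x 0) (≤-reflexive x+d≡nᵢ)))
  unionFrom i odd x (suc d) x+d≡nᵢ =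
    node ∪op (inp (C i odd x (≤-trans (m≤m+n x (suc d)) (≤-reflexive x+d≡nᵢ))))
             (unionFrom i odd (suc x) d (trans (sym (+-suc x d)) x+d≡nᵢ))

  size-unionFrom : (i : Fin c) (odd : toℕ i % 2 ≡ 1) (x d : ℕ) (x+d≡nᵢ : x + d ≡ nᵢ α i) →
                   size (unionFrom i odd x d x+d≡nᵢ) ≡ d
  size-unionFrom i odd x zero    _ = refl
  size-unionFrom i odd x (suc d) _ = cong suc (size-unionFrom i odd (suc x) d _)

  atTarget fromTarget : (i : Fin c) → toℕ i % 2 ≡ 1 → Expr (Given α)
  atTarget   i odd = inp (C i odd (toℕ (f i)) (entry≤nᵢ f i))
  fromTarget i odd = unionFrom i odd (toℕ (f i)) (nᵢ α i ∸ toℕ (f i)) (m+[n∸m]≡n (entry≤nᵢ f i))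

  step : Fin c → Expr (Given α) → Expr (Given α)
  step i e with trivialOrOdd i
  ... | inj₁ _   = e
  ... | inj₂ odd = node ∪op (node ∖op (fromTarget i odd) (atTarget i odd)) (node ∩op (atTarget i odd) e)

  prefixUpset : (m : ℕ) → m ≤ c → Expr (Given α)
  prefixUpset zero    _   = unionFrom i₁ i₁-odd 0 (nᵢ α i₁) refl
  prefixUpset (suc m) m<c = step (fromℕ< m<c) (prefixUpset m (<⇒≤ m<c))

  upset : Expr (Given α)
  upset = node ∪op (inp S⊤) (prefixUpset c ≤-refl)

  -- Cost of a step: 3 + (nᵢ - f i) operations, at most 4·|P_i| as P_i ≠ ∅.
  size-step : PrioritiesNonempty α → (i : Fin c) (e : Expr (Given α)) →
              size (step i e) ≤ 4 * |P| α i + size e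
  size-step nonempty i e with trivialOrOdd i
  ... | inj₁ _   = m≤n+m (size e) _
  ... | inj₂ odd = begin
      suc (suc (size (fromTarget i odd) + 0) + suc (size e))
        ≡⟨ cong (λ d → suc (suc (d + 0) + suc (size e))) (size-unionFrom i odd _ _ _) ⟩
      suc (suc (d + 0) + suc (size e))
        ≡⟨ regroup d (size e) ⟩
      3 + d + size e
        ≤⟨ +-monoˡ-≤ (size e) (+-monoʳ-≤ 3 d≤|P|) ⟩
      3 + |P| α i + size e
        ≤⟨ +-monoˡ-≤ (size e) (+-monoˡ-≤ (|P| α i) (*-monoʳ-≤ 3 (|P|-odd-positive nonempty i odd))) ⟩
      3 * |P| α i + |P| α i + size e
        ≡⟨ cong (_+ size e) (+-comm (3 * |P| α i) (|P| α i)) ⟩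
      4 * |P| α i + size e ∎
    where
    open ≤-Reasoning
    d : ℕ
    d = nᵢ α i ∸ toℕ (f i)
    d≤|P| : d ≤ |P| α i
    d≤|P| = ≤-trans (m∸n≤m (nᵢ α i) (toℕ (f i))) (nᵢ≤|P| i)
    regroup : (x y : ℕ) → suc (suc (x + 0) + suc y) ≡ 3 + x + y
    regroup = solve-∀

  size-prefixUpset : PrioritiesNonempty α → (m : ℕ) (m≤c : m ≤ c) →
                     size (prefixUpset m m≤c) ≤ n + 4 * below m
  size-prefixUpset nonempty zero _ = begin
      size (unionFrom i₁ i₁-odd 0 (nᵢ α i₁) refl) ≡⟨ size-unionFrom i₁ i₁-odd 0 _ refl ⟩
      nᵢ α i₁                                    ≤⟨ ≤-trans (nᵢ≤|P| i₁) (|P|≤n i₁) ⟩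
      n                                          ≤⟨ m≤m+n n _ ⟩
      n + 4 * below 0 ∎
    where open ≤-Reasoning
  size-prefixUpset nonempty (suc m) m<c = begin
      size (step i (prefixUpset m (<⇒≤ m<c)))
        ≤⟨ size-step nonempty i _ ⟩
      4 * |P| α i + size (prefixUpset m (<⇒≤ m<c))
        ≤⟨ +-monoʳ-≤ (4 * |P| α i) (size-prefixUpset nonempty m (<⇒≤ m<c)) ⟩
      4 * |P| α i + (n + 4 * below m)
        ≡⟨ regroup (|P| α i) n (below m) ⟩
      n + 4 * (|P| α i + below m)
        ≡⟨ cong (λ b → n + 4 * b) (sym (below-suc i (toℕ-fromℕ< m<c))) ⟩
      n + 4 * below (suc m) ∎
    where
    open ≤-Reasoning
    i : Fin c
    i = fromℕ< m<c
    regroup : (p x b : ℕ) → 4 * p + (x + 4 * b) ≡ x + 4 * (p + b)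
    regroup = solve-∀

  size-upset : PrioritiesNonempty α → size upset ≤ 5 * suc n
  size-upset nonempty = begin
      suc (size (prefixUpset c ≤-refl)) ≤⟨ s≤s (size-prefixUpset nonempty c ≤-refl) ⟩
      suc (n + 4 * below c)             ≤⟨ s≤s (+-monoʳ-≤ n (*-monoʳ-≤ 4 (below≤n c))) ⟩
      suc (n + 4 * n)                   ≤⟨ +-monoʳ-≤ (suc n) (*-monoʳ-≤ 4 (n≤1+n n)) ⟩
      5 * suc n ∎
    where open ≤-Reasoning

  module Semantics (ρ : RankingFunction α) where
    open RankSets ρ
    open import Relation.Binary.Reasoning.Setoid (≐-setoid (Fin n) 0ℓ)

    ⟦_⟧ : Expr (Given α) → Pred (Fin n) 0ℓ
    ⟦_⟧ = evalExpr ⟦ ρ ⟧Given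

    unionFrom-sem : (i : Fin c) (odd : toℕ i % 2 ≡ 1) (x d : ℕ) (x+d≡nᵢ : x + d ≡ nᵢ α i) →
                    ⟦ unionFrom i odd x d x+d≡nᵢ ⟧ ≐ RankSat (λ g → x ≤ toℕ (g i))
    unionFrom-sem i odd x zero x+d≡nᵢ = RankSat-cong
      ( (λ eq → ≤-reflexive (sym eq))
      , λ {g} le → ≤-antisym (≤-trans (entry≤nᵢ g i) (≤-reflexive (trans (sym x+d≡nᵢ) (+-identityʳ x))))
                             le )
    unionFrom-sem i odd x (suc d) x+d≡nᵢ = begin
      RankSat (λ g → toℕ (g i) ≡ x) ∪ ⟦ unionFrom i odd (suc x) d _ ⟧
        ≈⟨ ∪-cong ≐-refl (unionFrom-sem i odd (suc x) d _) ⟩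
      RankSat (λ g → toℕ (g i) ≡ x) ∪ RankSat (λ g → suc x ≤ toℕ (g i))
        ≈⟨ RankSat-∪ ⟩
      RankSat ((λ g → toℕ (g i) ≡ x) ∪ (λ g → suc x ≤ toℕ (g i)))
        ≈⟨ RankSat-cong ( [ (λ eq → ≤-reflexive (sym eq)) , <⇒≤ ]′
                        , λ le → [ inj₂ , (λ eq → inj₁ (sym eq)) ]′ (m≤n⇒m<n∨m≡n le) ) ⟩
      RankSat (λ g → x ≤ toℕ (g i)) ∎

    step-sem : (i : Fin c) {m : ℕ} → toℕ i ≡ m → (e : Expr (Given α)) →
               ⟦ e ⟧ ≐ RankSat (LexPrefix m) → ⟦ step i e ⟧ ≐ RankSat (LexPrefix (suc m))
    step-sem i refl e e-sem with trivialOrOdd i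
    ... | inj₁ trivial = ≐-trans e-sem (RankSat-cong (≐-sym (lexPrefix-trivial-step i trivial)))
    ... | inj₂ odd = begin
      (⟦ fromTarget i odd ⟧ ∩ ∁ ⟦ atTarget i odd ⟧) ∪ (⟦ atTarget i odd ⟧ ∩ ⟦ e ⟧)
        ≈⟨ ∪-cong (∩-cong (unionFrom-sem i odd (toℕ (f i)) _ (m+[n∸m]≡n (entry≤nᵢ f i))) ≐-refl)
                  (∩-cong ≐-refl e-sem) ⟩
      (RankSat (Above i) ∩ ∁ (RankSat (At i))) ∪ (RankSat (At i) ∩ RankSat (LexPrefix (toℕ i)))
        ≈⟨ ∪-cong RankSat-∖ RankSat-∩ ⟩
      RankSat (Above i ∩ ∁ (At i)) ∪ RankSat (At i ∩ LexPrefix (toℕ i))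
        ≈⟨ RankSat-∪ ⟩
      RankSat ((Above i ∩ ∁ (At i)) ∪ (At i ∩ LexPrefix (toℕ i)))
        ≈⟨ RankSat-cong (≐-sym (lexPrefix-step i)) ⟩
      RankSat (LexPrefix (suc (toℕ i))) ∎

    prefixUpset-sem : (m : ℕ) (m≤c : m ≤ c) → ⟦ prefixUpset m m≤c ⟧ ≐ RankSat (LexPrefix m)
    prefixUpset-sem zero _ =
      ≐-trans (unionFrom-sem i₁ i₁-odd 0 _ refl) (RankSat-cong ((λ _ → lex-zero) , (λ _ → z≤n)))
    prefixUpset-sem (suc m) m<c =
      step-sem (fromℕ< m<c) (toℕ-fromℕ< m<c) _ (prefixUpset-sem m (<⇒≤ m<c))

    upset-sem : ⟦ upset ⟧ ≐ (λ v → vec f ≤ᴿ ρ v)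
    upset-sem = begin
      (λ v → ρ v ≡ top) ∪ ⟦ prefixUpset c ≤-refl ⟧
        ≈⟨ ∪-cong ≐-refl (prefixUpset-sem c ≤-refl) ⟩
      (λ v → ρ v ≡ top) ∪ RankSat (LexPrefix c)
        ≈⟨ ∪-cong ≐-refl (RankSat-cong lexPrefix-all) ⟩
      (λ v → ρ v ≡ top) ∪ RankSat (λ g → vec f ≤ᴿ vec g)
        ≈⟨ vec-upset f ⟩
      (λ v → vec f ≤ᴿ ρ v) ∎

lemma5 : ∃ λ (K : ℕ) →
    (n c : ℕ) (α : Fin n → Fin c) → 2 ∣ c → PrioritiesNonempty α →
    (r : Rank α) →
    Σ ℕ λ k → (k ≤ K * suc n) × Σ (SLP (Given α) k) λ p → Σ (Operand (Given α) k) λ out →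
      (ρ : RankingFunction α) (v : Fin n) →
        evalOperand ⟦ ρ ⟧Given p out v ⇔ (r ≤ᴿ ρ v)
lemma5 = 5 , construct
  where
  construct : (n c : ℕ) (α : Fin n → Fin c) → 2 ∣ c → PrioritiesNonempty α → (r : Rank α) →
    Σ ℕ λ k → (k ≤ 5 * suc n) × Σ (SLP (Given α) k) λ p → Σ (Operand (Given α) k) λ out →
      (ρ : RankingFunction α) (v : Fin n) → evalOperand ⟦ ρ ⟧Given p out v ⇔ (r ≤ᴿ ρ v)
  construct n c α _ _ top =
    realise ⟦_⟧Given (λ ρ v → top ≤ᴿ ρ v) (inp S⊤) z≤n RankSets.top-upset
  -- With no priorities there are no vertices.
  construct n zero α _ _ (vec f) =
    realise ⟦_⟧Given (λ ρ v → vec f ≤ᴿ ρ v) (inp S⊤) z≤n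
      λ ρ → (λ {v} _ → ⊥-elim (¬Fin0 (α v))) , (λ {v} _ → ⊥-elim (¬Fin0 (α v)))
  construct n (suc zero) α 2∣1 _ (vec f) with ∣1⇒≡1 2∣1
  ... | ()
  -- Otherwise index 1 is odd and the construction applies.
  construct n (suc (suc c)) α _ nonempty (vec f) =
    realise ⟦_⟧Given (λ ρ v → vec f ≤ᴿ ρ v) upset (size-upset nonempty) (λ ρ → Semantics.upset-sem ρ)
    where open Construction α f (Data.Fin.suc Data.Fin.zero) refl
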